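{- The family $\{K_\lambda\}$ of weak shifted stable Grothendieck polynomials does not lie in the ring of signed symmetric functions; that is, there is a strict partition $\lambda$ such that some homogeneous component of $K_\lambda$ is not in the ring spanned by the odd power sum symmetric functions $p_1,p_3,p_5,\ldots$.
   Context: A strict partition $\lambda$ gives a shifted shape with boxes $(i,j)$, $i\le j\le i+\lambda_i-1$; boxes $(i,i)$ form the main diagonal. Use the ordered alphabet $1'<1<2'<2<\cdots$. A weak set-valued shifted tableau of shape $\lambda$ fills each box with a finite nonempty multiset of this alphabet such that: (1) the smallest entry of a box is $\ge$ the largest entry of the box directly to its left; (2) the smallest entry of a box is $\ge$ the largest entry of the box directly above; (3) no primed entries on the main diagonal; (4) each unprimed integer appears in at most one box per column; (5) each primed integer appears in at most one box per row. $x^T=\prod_i x_i^{a_i}$ with $a_i$ the number of occurrences of $i$ and $i'$ in $T$; $K_\lambda=\sum_T x^T$ over all weak set-valued shifted tableaux of shape $\lambda$. The ring of signed symmetric functions is the ring spanned (generated) by the odd power sums $p_k=\sum_i x_i^k$, $k$ odd. -}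

module Defs where

-- Formalization conventions:
-- * Variables x_1, x_2, ... ; a monomial x^a is given by a finite list
--   a = [a_1, ..., a_n] of exponents (all later exponents are 0).
-- * A formal power series in x_1, x_2, ... with rational coefficients is
--   represented by its coefficient function  List ℕ → ℚ.
-- * Letters of the alphabet 1' < 1 < 2' < 2 < ... are coded by naturals:
--   code 2k = (k+1)'  and  code 2k+1 = (k+1); the alphabet order is the
--   numeric order of codes.
-- * A box content (finite multiset of letters) is a list of multiplicities
--   m, where (lookupD m c) is the multiplicity of the letter with code c.

open import Data.Nat using (ℕ; zero; suc; _+_; _*_; _∸_; _≤_; _>_; _≡ᵇ_; _≤ᵇ_; _<ᵇ_; _%_; _/_)
open import Data.Bool using (Bool; true; false; _∧_; _∨_; not; if_then_else_)
open import Data.List using (List; []; _∷_; length; map; concat; concatMap; zip; zipWith; upTo; filterᵇ; and; all; any; foldr)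
open import Data.Nat.ListAction using (sum)
open import Data.List.Relation.Unary.All using (All)
open import Data.List.Relation.Unary.Linked using (Linked)
open import Data.Maybe using (Maybe; just; nothing)
open import Data.Product using (Σ; _×_; _,_; ∃-syntax)
open import Data.Integer using (+_)
open import Data.Rational using (ℚ; 0ℚ) renaming (_+_ to _+ℚ_; _*_ to _*ℚ_; _/_ to _/ℚ_)
open import Relation.Binary.PropositionalEquality using (_≡_)

IsStrictPartition : List ℕ → Set
IsStrictPartition la = All (λ p → p > 0) la × Linked _>_ la

lookupD : List ℕ → ℕ → ℕ
lookupD []       _       = 0
lookupD (x ∷ xs) zero    = x
lookupD (x ∷ xs) (suc i) = lookupD xs i

sequences : {A : Set} → List A → ℕ → List (List A)
sequences xs zero    = [] ∷ []
sequences xs (suc m) = concatMap (λ x → map (x ∷_) (sequences xs m)) xs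

-- Shifted shapes (0-indexed): boxes (i , j) with i < ℓ(λ) and
-- i ≤ j ≤ i + λ_{i+1} - 1 ; the main diagonal is i = j.

Box : Set
Box = ℕ × ℕ

boxes : List ℕ → List Box
boxes la = concat (zipWith row (upTo (length la)) la)
  where
  row : ℕ → ℕ → List Box
  row i l = map (λ k → (i , i + k)) (upTo l)

Multiset : Set
Multiset = List ℕ

isPrimedCode : ℕ → Bool
isPrimedCode c = (c % 2) ≡ᵇ 0

-- the index k of the variable x_k attached to letter k or k' (0-based)
letterIndex : ℕ → ℕ
letterIndex c = c / 2

present : Multiset → List ℕ
present m = filterᵇ (λ c → 1 ≤ᵇ lookupD m c) (upTo (length m))

nonempty : Multiset → Bool
nonempty m = any (λ _ → true) (present m)

maxLeMin : Multiset → Multiset → Bool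
maxLeMin m m' = all (λ c → all (λ c' → c ≤ᵇ c') (present m')) (present m)

sharedCode : (ℕ → Bool) → Multiset → Multiset → Bool
sharedCode P m m' = any (λ c → P c ∧ (1 ≤ᵇ lookupD m' c)) (present m)

-- Weak set-valued shifted tableaux.
-- A filling of the shape λ is a list of box contents, listed in the
-- order of (boxes λ).

Filling : Set
Filling = List Multiset

boxEq : Box → Box → Bool
boxEq (i , j) (i' , j') = (i ≡ᵇ i') ∧ (j ≡ᵇ j')

lookupBox : List (Box × Multiset) → Box → Maybe Multiset
lookupBox []              b = nothing
lookupBox ((b' , m) ∷ tb) b = if boxEq b' b then just m else lookupBox tb b

module _ (tb : List (Box × Multiset)) where

  leftOK : Box → Multiset → Bool
  leftOK (i , zero)  m = true
  leftOK (i , suc j) m with lookupBox tb (i , j)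
  ... | nothing = true
  ... | just m' = maxLeMin m' m

  aboveOK : Box → Multiset → Bool
  aboveOK (zero  , j) m = true
  aboveOK (suc i , j) m with lookupBox tb (i , j)
  ... | nothing = true
  ... | just m' = maxLeMin m' m

  diagOK : Box → Multiset → Bool
  diagOK (i , j) m = not (i ≡ᵇ j) ∨ all (λ c → not (isPrimedCode c)) (present m)

  -- conditions (4) and (5): for two different boxes in the same column
  -- no unprimed letter occurs in both; for two different boxes in the same
  -- row no primed letter occurs in both
  pairOK : Box × Multiset → Box × Multiset → Bool
  pairOK ((i , j) , m) ((i' , j') , m') =
    (not ((j ≡ᵇ j') ∧ not (i ≡ᵇ i')) ∨ not (sharedCode (λ c → not (isPrimedCode c)) m m'))
    ∧ (not ((i ≡ᵇ i') ∧ not (j ≡ᵇ j')) ∨ not (sharedCode isPrimedCode m m'))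

  tableauConds : Bool
  tableauConds =
    all (λ { (b , m) → nonempty m ∧ leftOK b m ∧ aboveOK b m ∧ diagOK b m }) tb
    ∧ all (λ p → all (λ q → pairOK p q) tb) tb

isWeakSetValuedShiftedTableau : List ℕ → Filling → Bool
isWeakSetValuedShiftedTableau la F =
  (length F ≡ᵇ length (boxes la)) ∧ tableauConds (zip (boxes la) F)

occurrences : Filling → ℕ → ℕ
occurrences F k = sum (map (λ m → lookupD m (2 * k) + lookupD m (suc (2 * k))) F)

-- x^T = x^a, where a = [a_1..a_n]: every letter used has index < n, and the
-- numbers of occurrences match
hasWeight : List ℕ → Filling → Bool
hasWeight a F =
  all (λ m → length m ≡ᵇ 2 * length a) F
  ∧ all (λ k → occurrences F k ≡ᵇ lookupD a k) (upTo (length a))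

-- All candidate fillings for weight a: each box gets a multiplicity list of
-- length 2n (letters 1',1,...,n',n) with multiplicities ≤ a_1+...+a_n.
-- Every tableau T with x^T = x^a is among them.
candidateFillings : List ℕ → List ℕ → List Filling
candidateFillings la a =
  sequences (sequences (upTo (suc (sum a))) (2 * length a)) (length (boxes la))

Kcoeff : List ℕ → List ℕ → ℕ
Kcoeff la a =
  length (filterᵇ (λ F → isWeakSetValuedShiftedTableau la F ∧ hasWeight a F)
                  (candidateFillings la a))

PowerSeries : Set
PowerSeries = List ℕ → ℚ

fromℕℚ : ℕ → ℚ
fromℕℚ n = (+ n) /ℚ 1

K : List ℕ → PowerSeries
K la a = fromℕℚ (Kcoeff la a)

component : ℕ → PowerSeries → PowerSeries
component d f a = if sum a ≡ᵇ d then f a else 0ℚ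

-- coefficient of x^a in p_{k_1} p_{k_2} ... p_{k_r}, p_k = Σ_i x_i^k:
-- number of choices of variable indices g_1..g_r (all < n, since variables
-- beyond x_n have exponent 0 in x^a) such that Σ_{g_j = i} k_j = a_i.
powerSumProductCoeff : List ℕ → List ℕ → ℕ
powerSumProductCoeff ks a =
  length (filterᵇ ok (sequences (upTo (length a)) (length ks)))
  where
  ok : List ℕ → Bool
  ok g = all (λ i → sum (map (λ { (k , gi) → if gi ≡ᵇ i then k else 0 }) (zip ks g))
                      ≡ᵇ lookupD a i)
             (upTo (length a))

Odd : ℕ → Set
Odd k = Σ ℕ (λ m → k ≡ suc (2 * m))

evalCombination : List (ℚ × List ℕ) → PowerSeries
evalCombination L a =
  foldr (λ { (c , ks) acc → (c *ℚ fromℕℚ (powerSumProductCoeff ks a)) +ℚ acc }) 0ℚ L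

InSignedSymmetricRing : PowerSeries → Set
InSignedSymmetricRing f =
  ∃[ L ] (All (λ { (c , ks) → All Odd ks }) L × (∀ a → f a ≡ evalCombination L a))

-- In degree 2 the ring ℚ[p₁, p₃, p₅, …] is spanned by p₁² = Σ xᵢ² + 2 Σ_{i<j} xᵢxⱼ, so in each of
-- its elements the coefficient of x₁x₂ is twice that of x₁². For the single box λ = (1) the
-- degree-2 part of K_λ is Σ xᵢ² + Σ_{i<j} xᵢxⱼ (box contents {i,i} and {i,j}), whose two
-- coefficients are both 1.
module Submission where

open import Defs
open import Data.Bool using (Bool; true; false; _∧_; T; if_then_else_)
open import Data.Bool.Properties using (∧-zeroʳ)
open import Data.Integer using (+_)
import Data.Integer as ℤ
import Data.Integer.Properties as ℤ
open import Data.List using (List; []; _∷_; length; map; _++_; concatMap; filterᵇ; upTo; zip)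
open import Data.List.Relation.Unary.All using (All; []; _∷_)
open import Data.List.Relation.Unary.Linked using ([-])
open import Data.Nat using (ℕ; zero; suc; _+_; _*_; _<_; _≡ᵇ_; z≤n; s≤s)
open import Data.Nat.ListAction using (sum)
open import Data.Nat.Properties using (+-identityʳ; *-suc; ≡ᵇ⇒≡; >⇒≢; m≤m+n; <-≤-trans)
open import Data.Product using (_×_; _,_; ∃-syntax)
open import Data.Rational using (toℚᵘ) renaming (_+_ to _+ℚ_; _*_ to _*ℚ_)
open import Data.Rational.Properties using (toℚᵘ-injective; toℚᵘ-fromℚᵘ; toℚᵘ-homo-+)
import Data.Rational.Properties as ℚ
import Data.Rational.Unnormalised.Base as ℚᵘ
import Data.Rational.Unnormalised.Properties as ℚᵘ
open import Function using (_∘_)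
open import Algebra.Bundles using (CommutativeMonoid)
import Algebra.Properties.CommutativeSemigroup as CommutativeSemigroupProperties
open import Relation.Nullary using (¬_; contradiction)
open import Relation.Binary.PropositionalEquality

count : {A : Set} → (A → Bool) → List A → ℕ
count P xs = length (filterᵇ P xs)

count-++ : {A : Set} (P : A → Bool) (xs ys : List A) → count P (xs ++ ys) ≡ count P xs + count P ys
count-++ P []       ys = refl
count-++ P (x ∷ xs) ys with P x
... | true  = cong suc (count-++ P xs ys)
... | false = count-++ P xs ys

count-map : {A B : Set} (P : B → Bool) (f : A → B) (xs : List A) → count P (map f xs) ≡ count (P ∘ f) xs
count-map P f []       = refl
count-map P f (x ∷ xs) with P (f x)
... | true  = cong suc (count-map P f xs)
... | false = count-map P f xs

count-cong : {A : Set} {P Q : A → Bool} → (∀ x → P x ≡ Q x) → (xs : List A) → count P xs ≡ count Q xs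
count-cong                 P≗Q []       = refl
count-cong {P = P} {Q = Q} P≗Q (x ∷ xs) with P x | Q x | P≗Q x
... | true  | .true  | refl = cong suc (count-cong P≗Q xs)
... | false | .false | refl = count-cong P≗Q xs

count-none : {A : Set} {P : A → Bool} → (∀ x → P x ≡ false) → (xs : List A) → count P xs ≡ 0
count-none                 P≗false []       = refl
count-none {P = P} P≗false (x ∷ xs) with P x | P≗false x
... | false | refl = count-none P≗false xs

count-prefixed : {A : Set} (P : List A → Bool) (xs : List A) (yss : List (List A)) →
  count P (concatMap (λ x → map (x ∷_) yss) xs) ≡ sum (map (λ x → count (P ∘ (x ∷_)) yss) xs)
count-prefixed P []       yss = refl
count-prefixed P (x ∷ xs) yss = begin
  count P (map (x ∷_) yss ++ concatMap (λ x → map (x ∷_) yss) xs)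
    ≡⟨ count-++ P (map (x ∷_) yss) _ ⟩
  count P (map (x ∷_) yss) + count P (concatMap (λ x → map (x ∷_) yss) xs)
    ≡⟨ cong₂ _+_ (count-map P (x ∷_) yss) (count-prefixed P xs yss) ⟩
  count (P ∘ (x ∷_)) yss + sum (map (λ x → count (P ∘ (x ∷_)) yss) xs)
    ∎
  where open ≡-Reasoning

choices : ℕ → ℕ → List (List ℕ)
choices n r = sequences (upTo n) r

-- the sum inside powerSumProductCoeff, named so that types can mention it
exponent : List ℕ → List ℕ → ℕ → ℕ
exponent ks g i = sum (map (λ { (k , gi) → if gi ≡ᵇ i then k else 0 }) (zip ks g))

count-choices₁ : ∀ P r → count P (choices 1 (suc r)) ≡ count (P ∘ (0 ∷_)) (choices 1 r)
count-choices₁ P r = trans (count-prefixed P (upTo 1) (choices 1 r)) (+-identityʳ _)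

count-choices₂ : ∀ P r →
  count P (choices 2 (suc r)) ≡ count (P ∘ (0 ∷_)) (choices 2 r) + count (P ∘ (1 ∷_)) (choices 2 r)
count-choices₂ P r = trans (count-prefixed P (upTo 2) (choices 2 r))
  (cong (λ n → count (P ∘ (0 ∷_)) (choices 2 r) + n) (+-identityʳ _))

atPred : (ℕ → ℕ) → ℕ → ℕ
atPred f zero    = 0
atPred f (suc n) = f n

coeff₁ : List ℕ → ℕ → ℕ
coeff₁ ks s = powerSumProductCoeff ks (s ∷ [])

coeff₂ : List ℕ → ℕ → ℕ → ℕ
coeff₂ ks s t = powerSumProductCoeff ks (s ∷ t ∷ [])

-- After splitting on the variable chosen for the factor p₁, each part is, up to unfolding,
-- either empty or the count for the remaining factors with one exponent lowered.
coeff₁-p₁ : ∀ ks s → coeff₁ (1 ∷ ks) s ≡ atPred (coeff₁ ks) s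
coeff₁-p₁ ks zero    = trans (count-choices₁ _ (length ks)) (count-none (λ g → refl) (choices 1 (length ks)))
coeff₁-p₁ ks (suc s) = trans (count-choices₁ _ (length ks)) (count-cong (λ g → refl) (choices 1 (length ks)))

coeff₂-p₁ : ∀ ks s t → coeff₂ (1 ∷ ks) s t ≡ atPred (λ s′ → coeff₂ ks s′ t) s + atPred (coeff₂ ks s) t
coeff₂-p₁ ks zero    zero    = trans (count-choices₂ _ (length ks))
  (cong₂ _+_ (count-none (λ g → refl) gs) (count-none (λ g → ∧-zeroʳ _) gs))
  where gs = choices 2 (length ks)
coeff₂-p₁ ks zero    (suc t) = trans (count-choices₂ _ (length ks))
  (cong₂ _+_ (count-none (λ g → refl) gs) (count-cong (λ g → refl) gs))
  where gs = choices 2 (length ks)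
coeff₂-p₁ ks (suc s) zero    = trans (count-choices₂ _ (length ks))
  (cong₂ _+_ (count-cong (λ g → refl) gs) (count-none (λ g → ∧-zeroʳ _) gs))
  where gs = choices 2 (length ks)
coeff₂-p₁ ks (suc s) (suc t) = trans (count-choices₂ _ (length ks))
  (cong₂ _+_ (count-cong (λ g → refl) gs) (count-cong (λ g → refl) gs))
  where gs = choices 2 (length ks)

≡ᵇ-false : ∀ {m n} → m ≢ n → (m ≡ᵇ n) ≡ false
≡ᵇ-false {m} {n} m≢n with m ≡ᵇ n in eq
... | false = refl
... | true  = contradiction (≡ᵇ⇒≡ m n (subst T (sym eq) _)) m≢n

+-≡ᵇ-below : ∀ k m {n} → n < k → (k + m ≡ᵇ n) ≡ false
+-≡ᵇ-below k m n<k = ≡ᵇ-false (>⇒≢ (<-≤-trans n<k (m≤m+n k m)))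

coeff₁-vanish : ∀ k ks {s} → s < k → coeff₁ (k ∷ ks) s ≡ 0
coeff₁-vanish k ks s<k = trans (count-choices₁ _ (length ks))
  (count-none (λ g → cong (_∧ true) (+-≡ᵇ-below k (exponent ks g 0) s<k)) (choices 1 (length ks)))

coeff₂-vanish : ∀ k ks {s t} → s < k → t < k → coeff₂ (k ∷ ks) s t ≡ 0
coeff₂-vanish k ks {s} {t} s<k t<k = trans (count-choices₂ _ (length ks))
  (cong₂ _+_ (count-none first gs) (count-none second gs))
  where
  gs = choices 2 (length ks)
  first : ∀ g → (k + exponent ks g 0 ≡ᵇ s) ∧ ((exponent ks g 1 ≡ᵇ t) ∧ true) ≡ false
  first g = cong (_∧ ((exponent ks g 1 ≡ᵇ t) ∧ true)) (+-≡ᵇ-below k (exponent ks g 0) s<k)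
  second : ∀ g → (exponent ks g 0 ≡ᵇ s) ∧ ((k + exponent ks g 1 ≡ᵇ t) ∧ true) ≡ false
  second g = trans (cong (λ b → (exponent ks g 0 ≡ᵇ s) ∧ (b ∧ true)) (+-≡ᵇ-below k (exponent ks g 1) t<k))
                   (∧-zeroʳ (exponent ks g 0 ≡ᵇ s))

data OddView : ℕ → Set where
  one        : OddView 1
  three-plus : ∀ j → OddView (3 + j)

oddView : ∀ {k} → Odd k → OddView k
oddView (zero  , refl) = one
oddView (suc m , refl) rewrite *-suc 2 m = three-plus (2 * m)

coeff₂-0-0 : ∀ {ks} → All Odd ks → coeff₂ ks 0 0 ≡ coeff₁ ks 0
coeff₂-0-0 []                         = refl
coeff₂-0-0 {k ∷ ks} ((m , refl) ∷ _) = trans (coeff₂-vanish k ks 0<k 0<k) (sym (coeff₁-vanish k ks 0<k))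
  where 0<k = s≤s z≤n

coeff₂-1-0 : ∀ {ks} → All Odd ks → coeff₂ ks 1 0 ≡ coeff₁ ks 1
coeff₂-1-0 []                     = refl
coeff₂-1-0 {k ∷ ks} (odd-k ∷ odd-ks) with oddView odd-k
... | one          = begin
  coeff₂ (1 ∷ ks) 1 0  ≡⟨ coeff₂-p₁ ks 1 0 ⟩
  coeff₂ ks 0 0 + 0    ≡⟨ +-identityʳ _ ⟩
  coeff₂ ks 0 0        ≡⟨ coeff₂-0-0 odd-ks ⟩
  coeff₁ ks 0          ≡⟨ coeff₁-p₁ ks 1 ⟨
  coeff₁ (1 ∷ ks) 1    ∎
  where open ≡-Reasoning
... | three-plus j = trans (coeff₂-vanish k ks (s≤s (s≤s z≤n)) (s≤s z≤n))
                           (sym (coeff₁-vanish k ks (s≤s (s≤s z≤n))))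

coeff₂-0-1 : ∀ {ks} → All Odd ks → coeff₂ ks 0 1 ≡ coeff₁ ks 1
coeff₂-0-1 []                     = refl
coeff₂-0-1 {k ∷ ks} (odd-k ∷ odd-ks) with oddView odd-k
... | one          = begin
  coeff₂ (1 ∷ ks) 0 1  ≡⟨ coeff₂-p₁ ks 0 1 ⟩
  coeff₂ ks 0 0        ≡⟨ coeff₂-0-0 odd-ks ⟩
  coeff₁ ks 0          ≡⟨ coeff₁-p₁ ks 1 ⟨
  coeff₁ (1 ∷ ks) 1    ∎
  where open ≡-Reasoning
... | three-plus j = trans (coeff₂-vanish k ks (s≤s z≤n) (s≤s (s≤s z≤n)))
                           (sym (coeff₁-vanish k ks (s≤s (s≤s z≤n))))

coeff₂-1-1 : ∀ {ks} → All Odd ks → coeff₂ ks 1 1 ≡ coeff₁ ks 2 + coeff₁ ks 2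
coeff₂-1-1 []                     = refl
coeff₂-1-1 {k ∷ ks} (odd-k ∷ odd-ks) with oddView odd-k
... | one          = begin
  coeff₂ (1 ∷ ks) 1 1                  ≡⟨ coeff₂-p₁ ks 1 1 ⟩
  coeff₂ ks 0 1 + coeff₂ ks 1 0        ≡⟨ cong₂ _+_ (coeff₂-0-1 odd-ks) (coeff₂-1-0 odd-ks) ⟩
  coeff₁ ks 1 + coeff₁ ks 1            ≡⟨ cong₂ _+_ (coeff₁-p₁ ks 2) (coeff₁-p₁ ks 2) ⟨
  coeff₁ (1 ∷ ks) 2 + coeff₁ (1 ∷ ks) 2 ∎
  where open ≡-Reasoning
... | three-plus j = trans (coeff₂-vanish k ks 1<k 1<k)
                           (sym (cong₂ _+_ (coeff₁-vanish k ks 2<k) (coeff₁-vanish k ks 2<k)))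
  where
  1<k = s≤s (s≤s z≤n)
  2<k = s≤s (s≤s (s≤s z≤n))

fromℕℚ-+ : ∀ m n → fromℕℚ (m + n) ≡ fromℕℚ m +ℚ fromℕℚ n
fromℕℚ-+ m n = toℚᵘ-injective (begin
  toℚᵘ (fromℕℚ (m + n))                 ≈⟨ toℚᵘ-fromℚᵘ (ℕᵘ (m + n)) ⟩
  ℕᵘ (m + n)                             ≈⟨ ℚᵘ.≃-reflexive ℕᵘ-+ ⟩
  ℕᵘ m ℚᵘ.+ ℕᵘ n                         ≈⟨ ℚᵘ.+-cong (toℚᵘ-fromℚᵘ (ℕᵘ m)) (toℚᵘ-fromℚᵘ (ℕᵘ n)) ⟨
  toℚᵘ (fromℕℚ m) ℚᵘ.+ toℚᵘ (fromℕℚ n)   ≈⟨ toℚᵘ-homo-+ (fromℕℚ m) (fromℕℚ n) ⟨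
  toℚᵘ (fromℕℚ m +ℚ fromℕℚ n)           ∎)
  where
  open ℚᵘ.≃-Reasoning
  ℕᵘ : ℕ → ℚᵘ.ℚᵘ
  ℕᵘ k = ℚᵘ.mkℚᵘ (+ k) 0
  ℕᵘ-+ : ℕᵘ (m + n) ≡ ℕᵘ m ℚᵘ.+ ℕᵘ n
  ℕᵘ-+ = cong (λ z → ℚᵘ.mkℚᵘ z 0)
    (trans (ℤ.pos-+ m n) (sym (cong₂ ℤ._+_ (ℤ.*-identityʳ (+ m)) (ℤ.*-identityʳ (+ n)))))

evalCombination-x₁x₂ : ∀ {L} → All (λ { (c , ks) → All Odd ks }) L →
  evalCombination L (1 ∷ 1 ∷ []) ≡ evalCombination L (2 ∷ []) +ℚ evalCombination L (2 ∷ [])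
evalCombination-x₁x₂ []                           = refl
evalCombination-x₁x₂ {(c , ks) ∷ L} (odd-ks ∷ odd-L) = begin
  c *ℚ fromℕℚ (coeff₂ ks 1 1) +ℚ evalCombination L (1 ∷ 1 ∷ [])
    ≡⟨ cong₂ (λ n e → c *ℚ fromℕℚ n +ℚ e) (coeff₂-1-1 odd-ks) (evalCombination-x₁x₂ odd-L) ⟩
  c *ℚ fromℕℚ (a + a) +ℚ (e +ℚ e)
    ≡⟨ cong (λ q → c *ℚ q +ℚ (e +ℚ e)) (fromℕℚ-+ a a) ⟩
  c *ℚ (fromℕℚ a +ℚ fromℕℚ a) +ℚ (e +ℚ e)
    ≡⟨ cong (_+ℚ (e +ℚ e)) (ℚ.*-distribˡ-+ c (fromℕℚ a) (fromℕℚ a)) ⟩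
  (c *ℚ fromℕℚ a +ℚ c *ℚ fromℕℚ a) +ℚ (e +ℚ e)
    ≡⟨ interchange (c *ℚ fromℕℚ a) (c *ℚ fromℕℚ a) e e ⟩
  (c *ℚ fromℕℚ a +ℚ e) +ℚ (c *ℚ fromℕℚ a +ℚ e)
    ∎
  where
  open ≡-Reasoning
  open CommutativeSemigroupProperties (CommutativeMonoid.commutativeSemigroup ℚ.+-0-commutativeMonoid)
    using (interchange)
  a = coeff₁ ks 2
  e = evalCombination L (2 ∷ [])

K₁-x₁x₂ : component 2 (K (1 ∷ [])) (1 ∷ 1 ∷ []) ≡ fromℕℚ 1
K₁-x₁x₂ = refl

K₁-x₁² : component 2 (K (1 ∷ [])) (2 ∷ []) ≡ fromℕℚ 1
K₁-x₁² = refl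

proposition3p4 : ∃[ la ] (IsStrictPartition la × ∃[ d ] (¬ InSignedSymmetricRing (component d (K la))))
proposition3p4 = 1 ∷ [] , (s≤s z≤n ∷ [] , [-]) , 2 , λ (L , odd , K≡L) → 1≢2 (begin
  fromℕℚ 1                                                  ≡⟨ trans (sym K₁-x₁x₂) (K≡L (1 ∷ 1 ∷ [])) ⟩
  evalCombination L (1 ∷ 1 ∷ [])                            ≡⟨ evalCombination-x₁x₂ odd ⟩
  evalCombination L (2 ∷ []) +ℚ evalCombination L (2 ∷ [])  ≡⟨ cong (λ q → q +ℚ q) (trans (sym (K≡L (2 ∷ []))) K₁-x₁²) ⟩
  fromℕℚ 1 +ℚ fromℕℚ 1                                      ∎)
  where
  open ≡-Reasoning
  1≢2 : fromℕℚ 1 ≢ fromℕℚ 1 +ℚ fromℕℚ 1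
  1≢2 ()
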